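{- Let $X$ be a $(95,40,12,20)$ strongly regular graph and let $K$ be a $4$-clique of $X$ that is not contained in any $5$-clique of $X$. For $i\in\{0,1,2,3\}$ let $X_i$ be the set of vertices of $V(X)\setminus V(K)$ having exactly $i$ neighbours in $K$, and suppose $(|X_0|,|X_1|,|X_2|,|X_3|)=(1,34,54,2)$. Then each of the two vertices of $X_3$ has exactly $11$ neighbours in $X_2$.
   Context: A $k$-regular graph $G$ on $v$ vertices is a $(v,k,\lambda,\mu)$ strongly regular graph if any two distinct adjacent vertices have exactly $\lambda$ common neighbours and any two distinct non-adjacent vertices have exactly $\mu$ common neighbours. -}

module Defs where

open import Data.Nat using (ℕ; zero; suc)
open import Data.Fin using (Fin; zero; suc)
open import Data.Product using (_×_; ∃-syntax)
open import Relation.Nullary using (¬_; Dec; yes; no)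
open import Relation.Nullary.Decidable using (_×-dec_; ¬?)
open import Relation.Binary.PropositionalEquality using (_≡_)
open import Data.Nat.Properties using (_≟_)
open import Data.Fin.Properties as FinP using ()
open import Data.Fin.Properties using (any?)

record Graph (n : ℕ) : Set₁ where
  field
    Adj    : Fin n → Fin n → Set
    adj?   : ∀ x y → Dec (Adj x y)
    sym    : ∀ {x y} → Adj x y → Adj y x
    irrefl : ∀ {x} → ¬ Adj x x

count : ∀ {n} {P : Fin n → Set} → (∀ x → Dec (P x)) → ℕ
count {zero}  d = 0
count {suc n} d with d zero
... | yes _ = suc (count (λ x → d (suc x)))
... | no  _ = count (λ x → d (suc x))

module _ {n : ℕ} (G : Graph n) where
  open Graph G

  degree : Fin n → ℕ
  degree x = count (λ y → adj? x y)

  commonNbrs : Fin n → Fin n → ℕ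
  commonNbrs x y = count (λ z → adj? x z ×-dec adj? y z)

  IsSRG : ℕ → ℕ → ℕ → ℕ → Set
  IsSRG v k l m =
    (v ≡ n) ×
    (∀ x → degree x ≡ k) ×
    (∀ x y → ¬ x ≡ y → Adj x y → commonNbrs x y ≡ l) ×
    (∀ x y → ¬ x ≡ y → ¬ Adj x y → commonNbrs x y ≡ m)

  IsClique : ∀ {s} → (Fin s → Fin n) → Set
  IsClique {s} K = ∀ (i j : Fin s) → ¬ i ≡ j → Adj (K i) (K j)

  InK : ∀ {s} → (Fin s → Fin n) → Fin n → Set
  InK K x = ∃[ j ] K j ≡ x

  InLargerClique : ∀ {s} → (Fin s → Fin n) → Set
  InLargerClique {s} K =
    ∃[ L ] (IsClique {suc s} L × (∀ j → ∃[ i ] L i ≡ K j))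

  nbrsInK : ∀ {s} → (Fin s → Fin n) → Fin n → ℕ
  nbrsInK K x = count (λ j → adj? x (K j))

  inK? : ∀ {s} (K : Fin s → Fin n) x → Dec (InK K x)
  inK? K x = any? (λ j → K j FinP.≟ x)

  InX : ∀ {s} → (Fin s → Fin n) → ℕ → Fin n → Set
  InX K i x = ¬ InK K x × nbrsInK K x ≡ i

  inX? : ∀ {s} (K : Fin s → Fin n) i x → Dec (InX K i x)
  inX? K i x = ¬? (inK? K x) ×-dec (nbrsInK K x ≟ i)

  sizeX : ∀ {s} → (Fin s → Fin n) → ℕ → ℕ
  sizeX K i = count (inX? K i)

  nbrsInX : ∀ {s} → (Fin s → Fin n) → ℕ → Fin n → ℕ
  nbrsInX K i x = count (λ y → adj? x y ×-dec inX? K i y)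

module Submission where

-- The adjacency operator A of a (95,40,12,20) strongly regular graph satisfies
-- A² = 20 I − 8 A + 20 J.  For every integer vector w, Cauchy–Schwarz gives
-- 95 ‖(A − 2) w‖² ≥ (Σ (A − 2) w)², and this identity turns it into an
-- inequality between ‖w‖², ⟨w, A w⟩ and Σ w.  Let z be the vertex of X₀, y the
-- other vertex of X₃ and d the vertex of K not adjacent to x.  All inner products
-- among χ_K, e_z, e_x, e_y, e_d and their images under A are determined by the
-- parameters, except for the adjacencies inside {z, x, y, d}; the inequality for
-- two integer combinations of these vectors forces x ~ z and x ≁ y.  Finally, by
-- maximality of K, 𝟙_{X₂} = A χ_K − 1 + 𝟙_{X₀} − 2·𝟙_{X₃} − 2 χ_K on all
-- vertices, and evaluating A of both sides at x gives 56 − 40 + 1 − 0 − 6 = 11.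

open import Defs
open import Data.Bool.Base using (Bool; true; false; _∧_; not)
open import Data.Empty using (⊥-elim)
open import Data.Fin.Base using (Fin; zero; suc)
import Data.Fin.Properties as FinP
open import Data.Integer.Base using (ℤ; +_; -[1+_]; 0ℤ; 1ℤ; -1ℤ; _+_; _-_; -_; _*_; _≤_; +≤+)
import Data.Integer.Properties as ℤP
open import Data.Integer.Properties using (0≤i-j⇒j≤i; i≤j⇒0≤j-i)
open import Data.Integer.Tactic.RingSolver using (solve-∀)
open import Data.Nat.Base as ℕ using (ℕ; zero; suc; z≤n; s≤s)
import Data.Nat.Properties as ℕP
open import Data.Product.Base using (_×_; _,_; proj₁; proj₂; ∃-syntax)
open import Data.Vec.Base using (_∷_; []; lookup)
open import Function.Base using (_∘_)
open import Function.Bundles using (mk⇔)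
open import Relation.Binary.PropositionalEquality
open import Relation.Nullary.Decidable
  using (Dec; yes; no; does; dec-true; dec-false; does-⇔; decidable-stable; _×-dec_; ¬?)
open import Relation.Nullary.Negation using (¬_; contradiction)
open import Algebra.Properties.Semiring.Sum ℤP.+-*-semiring
  using (sum; sum-cong-≗; ∑-distrib-+; ∑-comm; *-distribˡ-sum; *-distribʳ-sum; sum-replicate-zero)

open ≡-Reasoning

-- Sums and inner products of integer vectors

⟪_,_⟫ : ∀ {n} → (Fin n → ℤ) → (Fin n → ℤ) → ℤ
⟪ v , w ⟫ = sum (λ u → v u * w u)

⟪⟫-comm : ∀ {n} (v w : Fin n → ℤ) → ⟪ v , w ⟫ ≡ ⟪ w , v ⟫
⟪⟫-comm v w = sum-cong-≗ (λ u → ℤP.*-comm (v u) (w u))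

sum-mono-≤ : ∀ {n} {f g : Fin n → ℤ} → (∀ i → f i ≤ g i) → sum f ≤ sum g
sum-mono-≤ {zero}  f≤g = ℤP.≤-refl
sum-mono-≤ {suc n} f≤g = ℤP.+-mono-≤ (f≤g zero) (sum-mono-≤ (f≤g ∘ suc))

sum-nonneg : ∀ {n} {f : Fin n → ℤ} → (∀ i → 0ℤ ≤ f i) → 0ℤ ≤ sum f
sum-nonneg {n} {f} 0≤f = subst (_≤ sum f) (sum-replicate-zero n) (sum-mono-≤ 0≤f)

sum-const : ∀ {n} x → sum {n} (λ _ → x) ≡ + n * x
sum-const {zero}  x = sym (ℤP.*-zeroˡ x)
sum-const {suc n} x = trans (cong (_+_ x) (sum-const {n} x)) (succ x (+ n))
  where succ : ∀ x m → x + m * x ≡ (1ℤ + m) * x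
        succ = solve-∀

sum-*-sum : ∀ {m n} (f : Fin m → ℤ) (g : Fin n → ℤ) → sum f * sum g ≡ sum (λ i → sum (λ j → f i * g j))
sum-*-sum f g = trans (*-distribʳ-sum (sum g) f) (sum-cong-≗ (λ i → *-distribˡ-sum (f i) g))

sum-lin3 : ∀ {n} (p q r : ℤ) (f g h : Fin n → ℤ) →
           sum (λ i → p * f i + q * g i + r * h i) ≡ p * sum f + q * sum g + r * sum h
sum-lin3 p q r f g h = begin
  sum (λ i → p * f i + q * g i + r * h i)
    ≡⟨ trans (∑-distrib-+ (λ i → p * f i + q * g i) (λ i → r * h i))
             (cong (_+ sum (λ i → r * h i)) (∑-distrib-+ (λ i → p * f i) (λ i → q * g i))) ⟩
  sum (λ i → p * f i) + sum (λ i → q * g i) + sum (λ i → r * h i)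
    ≡⟨ cong₂ _+_ (cong₂ _+_ (sym (*-distribˡ-sum p f)) (sym (*-distribˡ-sum q g))) (sym (*-distribˡ-sum r h)) ⟩
  p * sum f + q * sum g + r * sum h ∎

⟪-,∑⟫ : ∀ {m n} (g : Fin n → ℤ) (φ : Fin m → Fin n → ℤ) →
        ⟪ g , (λ u → sum (λ k → φ k u)) ⟫ ≡ sum (λ k → ⟪ g , φ k ⟫)
⟪-,∑⟫ g φ = begin
  sum (λ u → g u * sum (λ k → φ k u))  ≡⟨ sum-cong-≗ (λ u → *-distribˡ-sum (g u) (λ k → φ k u)) ⟩
  sum (λ u → sum (λ k → g u * φ k u))  ≡⟨ ∑-comm (λ u k → g u * φ k u) ⟩
  sum (λ k → ⟪ g , φ k ⟫)              ∎

0≤i*i : ∀ i → 0ℤ ≤ i * i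
0≤i*i (+ n)    = subst (0ℤ ≤_) (ℤP.pos-* n n) (+≤+ z≤n)
0≤i*i -[1+ n ] = +≤+ z≤n

∑∑ : ∀ {n} → (Fin n → Fin n → ℤ) → ℤ
∑∑ F = sum (λ u → sum (λ u′ → F u u′))

∑∑-distrib-+ : ∀ {n} (F H : Fin n → Fin n → ℤ) → ∑∑ (λ u u′ → F u u′ + H u u′) ≡ ∑∑ F + ∑∑ H
∑∑-distrib-+ F H = trans (sum-cong-≗ (λ u → ∑-distrib-+ (F u) (H u))) (∑-distrib-+ (sum ∘ F) (sum ∘ H))

∑∑-scale : ∀ {n} c (F : Fin n → Fin n → ℤ) → ∑∑ (λ u u′ → c * F u u′) ≡ c * ∑∑ F
∑∑-scale c F = trans (sum-cong-≗ (λ u → sym (*-distribˡ-sum c (F u)))) (sym (*-distribˡ-sum c (sum ∘ F)))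

-- Σᵤ Σᵤ′ (w u − w u′)² = 2 (n ‖w‖² − (Σ w)²).
sum²≤n*⟪w,w⟫ : ∀ {n} (w : Fin n → ℤ) → sum w * sum w ≤ + n * ⟪ w , w ⟫
sum²≤n*⟪w,w⟫ {n} w =
  0≤i-j⇒j≤i (ℤP.*-cancelˡ-≤-pos 0ℤ (n‖w‖² - sum w * sum w) (+ 2) (subst (0ℤ ≤_) spread≡ spread≥0))
  where
  n‖w‖² = + n * ⟪ w , w ⟫
  spread = ∑∑ (λ u u′ → (w u - w u′) * (w u - w u′))
  spread≥0 : 0ℤ ≤ spread
  spread≥0 = sum-nonneg (λ u → sum-nonneg (λ u′ → 0≤i*i (w u - w u′)))
  square-diff : ∀ x y → (x - y) * (x - y) ≡ x * x + y * y + -[1+ 1 ] * (x * y)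
  square-diff = solve-∀
  twice : ∀ q s → q + q + -[1+ 1 ] * s ≡ + 2 * (q - s)
  twice = solve-∀
  spread≡ : spread ≡ + 2 * (n‖w‖² - sum w * sum w)
  spread≡ = begin
    spread
      ≡⟨ sum-cong-≗ (λ u → sum-cong-≗ (λ u′ → square-diff (w u) (w u′))) ⟩
    ∑∑ (λ u u′ → w u * w u + w u′ * w u′ + -[1+ 1 ] * (w u * w u′))
      ≡⟨ trans (∑∑-distrib-+ (λ u u′ → w u * w u + w u′ * w u′) (λ u u′ → -[1+ 1 ] * (w u * w u′)))
               (cong₂ _+_ (∑∑-distrib-+ (λ u u′ → w u * w u) (λ u u′ → w u′ * w u′))
                          (∑∑-scale -[1+ 1 ] (λ u u′ → w u * w u′))) ⟩
    ∑∑ (λ u u′ → w u * w u) + ∑∑ (λ u u′ → w u′ * w u′) + -[1+ 1 ] * ∑∑ (λ u u′ → w u * w u′)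
      ≡⟨ cong₂ _+_ (cong₂ _+_ (trans (sum-cong-≗ (λ u → sum-const {n} (w u * w u)))
                                     (sym (*-distribˡ-sum (+ n) (λ u → w u * w u))))
                              (sum-const {n} ⟪ w , w ⟫))
                   (cong (-[1+ 1 ] *_) (sym (sum-*-sum w w))) ⟩
    n‖w‖² + n‖w‖² + -[1+ 1 ] * (sum w * sum w)
      ≡⟨ twice n‖w‖² (sum w * sum w) ⟩
    + 2 * (n‖w‖² - sum w * sum w) ∎

linForm : ∀ {m} → (Fin m → ℤ) → (Fin m → ℤ) → ℤ
linForm c v = sum (λ k → c k * v k)

linForm-cong : ∀ {m} (c : Fin m → ℤ) {v w : Fin m → ℤ} → (∀ k → v k ≡ w k) → linForm c v ≡ linForm c w
linForm-cong c v≡w = sum-cong-≗ (λ k → cong (c k *_) (v≡w k))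

quadForm : ∀ {m} → (Fin m → ℤ) → (Fin m → Fin m → ℤ) → ℤ
quadForm c M = linForm c (λ k → linForm c (M k))

quadForm-cong : ∀ {m} (c : Fin m → ℤ) {M N : Fin m → Fin m → ℤ} →
                (∀ k l → M k l ≡ N k l) → quadForm c M ≡ quadForm c N
quadForm-cong c M≡N = linForm-cong c (λ k → linForm-cong c (M≡N k))

lc : ∀ {m n} → (Fin m → ℤ) → (Fin m → Fin n → ℤ) → Fin n → ℤ
lc c φ u = linForm c (λ k → φ k u)

⟪-,lc⟫ : ∀ {m n} (g : Fin n → ℤ) (c : Fin m → ℤ) (φ : Fin m → Fin n → ℤ) →
         ⟪ g , lc c φ ⟫ ≡ linForm c (λ k → ⟪ g , φ k ⟫)
⟪-,lc⟫ g c φ = begin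
  ⟪ g , lc c φ ⟫                               ≡⟨ ⟪-,∑⟫ g (λ k u → c k * φ k u) ⟩
  sum (λ k → sum (λ u → g u * (c k * φ k u)))  ≡⟨ sum-cong-≗ (λ k → sum-cong-≗ (λ u → swap (g u) (c k) (φ k u))) ⟩
  sum (λ k → sum (λ u → c k * (g u * φ k u)))  ≡⟨ sum-cong-≗ (λ k → sym (*-distribˡ-sum (c k) (λ u → g u * φ k u))) ⟩
  linForm c (λ k → ⟪ g , φ k ⟫)                ∎
  where swap : ∀ x y z → x * (y * z) ≡ y * (x * z)
        swap = solve-∀

⟪lc,lc⟫ : ∀ {m n} (c : Fin m → ℤ) (φ ψ : Fin m → Fin n → ℤ) →
          ⟪ lc c φ , lc c ψ ⟫ ≡ quadForm c (λ k l → ⟪ φ k , ψ l ⟫)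
⟪lc,lc⟫ c φ ψ = begin
  ⟪ lc c φ , lc c ψ ⟫                    ≡⟨ ⟪⟫-comm (lc c φ) (lc c ψ) ⟩
  ⟪ lc c ψ , lc c φ ⟫                    ≡⟨ ⟪-,lc⟫ (lc c ψ) c φ ⟩
  linForm c (λ k → ⟪ lc c ψ , φ k ⟫)     ≡⟨ linForm-cong c (λ k → trans (⟪⟫-comm (lc c ψ) (φ k)) (⟪-,lc⟫ (φ k) c ψ)) ⟩
  quadForm c (λ k l → ⟪ φ k , ψ l ⟫)     ∎

sum-lc : ∀ {m n} (c : Fin m → ℤ) (φ : Fin m → Fin n → ℤ) → sum (lc c φ) ≡ linForm c (sum ∘ φ)
sum-lc c φ = begin
  sum (lc c φ)                          ≡⟨ ∑-comm (λ u k → c k * φ k u) ⟩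
  sum (λ k → sum (λ u → c k * φ k u))  ≡⟨ sum-cong-≗ (λ k → sym (*-distribˡ-sum (c k) (φ k))) ⟩
  linForm c (sum ∘ φ)                   ∎

-- Indicators, unit vectors and counting

⟦_⟧ : Bool → ℤ
⟦ true  ⟧ = 1ℤ
⟦ false ⟧ = 0ℤ

⟦∧⟧ : ∀ b c → ⟦ b ∧ c ⟧ ≡ ⟦ b ⟧ * ⟦ c ⟧
⟦∧⟧ true  c = sym (ℤP.*-identityˡ ⟦ c ⟧)
⟦∧⟧ false c = refl

⟦⟧-idem : ∀ b → ⟦ b ⟧ * ⟦ b ⟧ ≡ ⟦ b ⟧
⟦⟧-idem true  = refl
⟦⟧-idem false = refl

𝟙 : ∀ {p} {P : Set p} → Dec P → ℤ
𝟙 P? = ⟦ does P? ⟧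

𝟙-yes : ∀ {p} {P : Set p} (P? : Dec P) → P → 𝟙 P? ≡ 1ℤ
𝟙-yes P? p = cong ⟦_⟧ (dec-true P? p)

𝟙-no : ∀ {p} {P : Set p} (P? : Dec P) → ¬ P → 𝟙 P? ≡ 0ℤ
𝟙-no P? ¬p = cong ⟦_⟧ (dec-false P? ¬p)

e : ∀ {n} → Fin n → Fin n → ℤ
e t u = 𝟙 (u FinP.≟ t)

e-same : ∀ {n} (t : Fin n) → e t t ≡ 1ℤ
e-same t = 𝟙-yes (t FinP.≟ t) refl

e-other : ∀ {n} {t u : Fin n} → u ≢ t → e t u ≡ 0ℤ
e-other {t = t} {u} = 𝟙-no (u FinP.≟ t)

e-sym : ∀ {n} (t u : Fin n) → e t u ≡ e u t
e-sym t u = cong ⟦_⟧ (does-⇔ (mk⇔ sym sym) (u FinP.≟ t) (t FinP.≟ u))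

⟪e,-⟫ : ∀ {n} (t : Fin n) (g : Fin n → ℤ) → ⟪ e t , g ⟫ ≡ g t
⟪e,-⟫ {suc n} zero g = begin
  1ℤ * g zero + sum {n} (λ u → 0ℤ * g (suc u))
    ≡⟨ cong₂ _+_ (ℤP.*-identityˡ (g zero)) (sum-cong-≗ (λ u → ℤP.*-zeroˡ (g (suc u)))) ⟩
  g zero + sum {n} (λ _ → 0ℤ)
    ≡⟨ cong (_+_ (g zero)) (sum-replicate-zero n) ⟩
  g zero + 0ℤ
    ≡⟨ ℤP.+-identityʳ (g zero) ⟩
  g zero ∎
⟪e,-⟫ {suc n} (suc t) g = begin
  0ℤ * g zero + ⟪ e t , g ∘ suc ⟫  ≡⟨ cong₂ _+_ (ℤP.*-zeroˡ (g zero)) (⟪e,-⟫ t (g ∘ suc)) ⟩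
  0ℤ + g (suc t)                    ≡⟨ ℤP.+-identityˡ (g (suc t)) ⟩
  g (suc t)                         ∎

⟪-,e⟫ : ∀ {n} (g : Fin n → ℤ) (t : Fin n) → ⟪ g , e t ⟫ ≡ g t
⟪-,e⟫ g t = trans (⟪⟫-comm g (e t)) (⟪e,-⟫ t g)

sum-e : ∀ {n} (t : Fin n) → sum (e t) ≡ 1ℤ
sum-e t = trans (sum-cong-≗ (λ u → sym (ℤP.*-identityʳ (e t u)))) (⟪e,-⟫ t (λ _ → 1ℤ))

count-sum : ∀ {n} {P : Fin n → Set} (P? : ∀ x → Dec (P x)) → + count P? ≡ sum (𝟙 ∘ P?)
count-sum {zero}  P? = refl
count-sum {suc n} P? with P? zero
... | yes _ = cong (_+_ 1ℤ) (count-sum (P? ∘ suc))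
... | no  _ = trans (count-sum (P? ∘ suc)) (sym (ℤP.+-identityˡ _))

count≤n : ∀ {n} {P : Fin n → Set} (P? : ∀ x → Dec (P x)) → count P? ℕ.≤ n
count≤n {zero}  P? = z≤n
count≤n {suc n} P? with P? zero
... | yes _ = s≤s (count≤n (P? ∘ suc))
... | no  _ = ℕP.m≤n⇒m≤1+n (count≤n (P? ∘ suc))

count≡n⇒all : ∀ {n} {P : Fin n → Set} (P? : ∀ x → Dec (P x)) → count P? ≡ n → ∀ x → P x
count≡n⇒all {suc n} P? eq x with P? zero
count≡n⇒all {suc n} P? eq zero    | yes p = p
count≡n⇒all {suc n} P? eq (suc x) | yes _ = count≡n⇒all (P? ∘ suc) (ℕP.suc-injective eq) x
... | no _ = contradiction (subst (ℕ._≤ n) eq (count≤n (P? ∘ suc))) ℕP.1+n≰n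

all⇒count≡n : ∀ {n} {P : Fin n → Set} (P? : ∀ x → Dec (P x)) → (∀ x → P x) → count P? ≡ n
all⇒count≡n {zero}  P? all = refl
all⇒count≡n {suc n} P? all with P? zero
... | yes _ = cong suc (all⇒count≡n (P? ∘ suc) (all ∘ suc))
... | no ¬p = contradiction (all zero) ¬p

count≡0⇒none : ∀ {n} {P : Fin n → Set} (P? : ∀ x → Dec (P x)) → count P? ≡ 0 → ∀ x → ¬ P x
count≡0⇒none {suc n} P? eq x with P? zero
count≡0⇒none {suc n} P? eq zero    | no ¬p = ¬p
count≡0⇒none {suc n} P? eq (suc x) | no _  = count≡0⇒none (P? ∘ suc) eq x

count≡suc⇒some : ∀ {n k} {P : Fin n → Set} (P? : ∀ x → Dec (P x)) → count P? ≡ suc k → ∃[ x ] P x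
count≡suc⇒some {suc n} P? eq with P? zero
... | yes p = zero , p
... | no  _ = let x , p = count≡suc⇒some (P? ∘ suc) eq in suc x , p

module _ {n} {P : Fin n → Set} (P? : ∀ x → Dec (P x)) {x : Fin n} where

  without : ∀ u → Dec (P u × u ≢ x)
  without u = P? u ×-dec ¬? (u FinP.≟ x)

  𝟙-remove : P x → ∀ u → 𝟙 (P? u) ≡ e x u + 𝟙 (without u)
  𝟙-remove px u = by-cases (u FinP.≟ x)
    where
    by-cases : Dec (u ≡ x) → 𝟙 (P? u) ≡ e x u + 𝟙 (without u)
    by-cases (yes refl) = trans (𝟙-yes (P? u) px)
                                (sym (cong₂ _+_ (e-same u) (𝟙-no (without u) λ (_ , u≢u) → u≢u refl)))
    by-cases (no u≢x)   = trans (cong ⟦_⟧ (does-⇔ (mk⇔ (_, u≢x) proj₁) (P? u) (without u)))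
                                (sym (trans (cong (_+ 𝟙 (without u)) (e-other u≢x)) (ℤP.+-identityˡ _)))

  count-remove : P x → count P? ≡ suc (count without)
  count-remove px = ℤP.+-injective (begin
    + count P?                          ≡⟨ count-sum P? ⟩
    sum (𝟙 ∘ P?)                        ≡⟨ sum-cong-≗ (𝟙-remove px) ⟩
    sum (λ u → e x u + 𝟙 (without u))  ≡⟨ ∑-distrib-+ (e x) (𝟙 ∘ without) ⟩
    sum (e x) + sum (𝟙 ∘ without)      ≡⟨ cong₂ _+_ (sum-e x) (sym (count-sum without)) ⟩
    + suc (count without)               ∎)

count≡1⇒singleton : ∀ {n} {P : Fin n → Set} (P? : ∀ x → Dec (P x)) →
                    count P? ≡ 1 → ∃[ z ] P z × 𝟙 ∘ P? ≗ e z
count≡1⇒singleton {P = P} P? eq with count≡suc⇒some P? eq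
... | z , pz = z , pz , 𝟙≗e
  where
  only-z : ∀ u → P u → u ≡ z
  only-z u pu = decidable-stable (u FinP.≟ z) λ u≢z →
    count≡0⇒none (without P?) (ℕP.suc-injective (trans (sym (count-remove P? pz)) eq)) u (pu , u≢z)
  𝟙≗e : ∀ u → 𝟙 (P? u) ≡ e z u
  𝟙≗e u with P? u
  ... | yes pu = sym (trans (cong (e z) (only-z u pu)) (e-same z))
  ... | no ¬pu = sym (e-other λ u≡z → ¬pu (subst P (sym u≡z) pz))

count≡2⇒pair : ∀ {n} {P : Fin n → Set} (P? : ∀ x → Dec (P x)) {x} →
               count P? ≡ 2 → P x → ∃[ y ] y ≢ x × P y × 𝟙 ∘ P? ≗ (λ u → e x u + e y u)
count≡2⇒pair P? {x} eq px
  with count≡1⇒singleton (without P?) (ℕP.suc-injective (trans (sym (count-remove P? px)) eq))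
... | y , (py , y≢x) , 𝟙≗e = y , y≢x , py , λ u → trans (𝟙-remove P? px u) (cong (_+_ (e x u)) (𝟙≗e u))

-- The adjacency operator

module Adjacency {n} (G : Graph n) where
  open Graph G using (adj?; irrefl) renaming (sym to adj-sym)

  does-adj-sym : ∀ u v → does (adj? u v) ≡ does (adj? v u)
  does-adj-sym u v = does-⇔ (mk⇔ adj-sym adj-sym) (adj? u v) (adj? v u)

  a : Fin n → Fin n → ℤ
  a u v = 𝟙 (adj? u v)

  a-sym : ∀ u v → a u v ≡ a v u
  a-sym u v = cong ⟦_⟧ (does-adj-sym u v)

  a-irrefl : ∀ u → a u u ≡ 0ℤ
  a-irrefl u = 𝟙-no (adj? u u) irrefl

  -- Opaque: otherwise comparing two syntactically different terms that contain
  -- A makes the type checker unfold the nested sums over all vertices.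
  opaque
    A : (Fin n → ℤ) → Fin n → ℤ
    A w u = ⟪ a u , w ⟫

    A-def : ∀ w u → A w u ≡ ⟪ a u , w ⟫
    A-def w u = refl

  A-cong : ∀ {v w} → v ≗ w → ∀ u → A v u ≡ A w u
  A-cong {v} {w} v≗w u = trans (A-def v u) (trans (sum-cong-≗ (λ t → cong (a u t *_) (v≗w t))) (sym (A-def w u)))

  A-e : ∀ t u → A (e t) u ≡ a u t
  A-e t u = trans (A-def (e t) u) (⟪-,e⟫ (a u) t)

  A-+ : ∀ v w u → A (λ t → v t + w t) u ≡ A v u + A w u
  A-+ v w u = begin
    A (λ t → v t + w t) u                  ≡⟨ A-def (λ t → v t + w t) u ⟩
    sum (λ t → a u t * (v t + w t))        ≡⟨ sum-cong-≗ (λ t → ℤP.*-distribˡ-+ (a u t) (v t) (w t)) ⟩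
    sum (λ t → a u t * v t + a u t * w t)  ≡⟨ ∑-distrib-+ (λ t → a u t * v t) (λ t → a u t * w t) ⟩
    ⟪ a u , v ⟫ + ⟪ a u , w ⟫              ≡⟨ cong₂ _+_ (A-def v u) (A-def w u) ⟨
    A v u + A w u                          ∎

  A-lc : ∀ {m} (c : Fin m → ℤ) (φ : Fin m → Fin n → ℤ) u → A (lc c φ) u ≡ lc c (A ∘ φ) u
  A-lc c φ u = trans (A-def (lc c φ) u) (trans (⟪-,lc⟫ (a u) c φ) (linForm-cong c (λ k → sym (A-def (φ k) u))))

  ⟪-,A⟫ : ∀ v w → ⟪ v , A w ⟫ ≡ ⟪ A v , w ⟫
  ⟪-,A⟫ v w = begin
    ⟪ v , A w ⟫                                    ≡⟨ sum-cong-≗ (λ u → cong (v u *_) (A-def w u)) ⟩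
    ⟪ v , (λ u → ⟪ a u , w ⟫) ⟫                     ≡⟨ ⟪-,∑⟫ v (λ t u → a u t * w t) ⟩
    sum (λ t → sum (λ u → v u * (a u t * w t)))   ≡⟨ sum-cong-≗ (λ t → sum-cong-≗ (λ u → swap (v u) (w t) (a-sym u t))) ⟩
    sum (λ t → sum (λ u → w t * (a t u * v u)))   ≡⟨ ∑-comm (λ t u → w t * (a t u * v u)) ⟩
    sum (λ u → sum (λ t → w t * (a t u * v u)))   ≡⟨ ⟪-,∑⟫ w (λ u t → a t u * v u) ⟨
    ⟪ w , (λ t → ⟪ a t , v ⟫) ⟫                     ≡⟨ sum-cong-≗ (λ t → cong (w t *_) (A-def v t)) ⟨
    ⟪ w , A v ⟫                                    ≡⟨ ⟪⟫-comm w (A v) ⟩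
    ⟪ A v , w ⟫                                    ∎
    where
    swap : ∀ x y {b c} → b ≡ c → x * (b * y) ≡ y * (c * x)
    swap x y {b} refl = comm x b y
      where comm : ∀ x b y → x * (b * y) ≡ y * (b * x)
            comm = solve-∀

  A-count : ∀ {P : Fin n → Set} (P? : ∀ x → Dec (P x)) u →
            + count (λ y → adj? u y ×-dec P? y) ≡ A (𝟙 ∘ P?) u
  A-count P? u = begin
    + count (λ y → adj? u y ×-dec P? y)             ≡⟨ count-sum (λ y → adj? u y ×-dec P? y) ⟩
    sum (λ y → ⟦ does (adj? u y) ∧ does (P? y) ⟧)  ≡⟨ sum-cong-≗ (λ y → ⟦∧⟧ (does (adj? u y)) (does (P? y))) ⟩
    ⟪ a u , 𝟙 ∘ P? ⟫                                 ≡⟨ A-def (𝟙 ∘ P?) u ⟨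
    A (𝟙 ∘ P?) u                                     ∎

-- Strongly regular graphs

-- n ‖(A − θ) w‖² − (Σ (A − θ) w)² for a (n, k, l, m) strongly regular graph,
-- expressed through Q = ‖w‖², R = ⟨w, A w⟩ and S = Σ w.  It is opaque for the
-- same reason as A; only the finite check `adjacency-forced` computes with it.
opaque
  defect : (n k l m : ℕ) (θ Q R S : ℤ) → ℤ
  defect n k l m θ Q R S =
    + n * ((+ k - + m + θ * θ) * Q + (+ l - + m - + 2 * θ) * R + + m * (S * S)) - (+ k - θ) * S * ((+ k - θ) * S)

  defect-def : ∀ n k l m θ Q R S → defect n k l m θ Q R S ≡
    + n * ((+ k - + m + θ * θ) * Q + (+ l - + m - + 2 * θ) * R + + m * (S * S)) - (+ k - θ) * S * ((+ k - θ) * S)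
  defect-def n k l m θ Q R S = refl

module StronglyRegular {n} (G : Graph n) {v k l m : ℕ} (srg : IsSRG G v k l m) where
  open Graph G using (Adj; adj?)
  open Adjacency G

  degree-sum : ∀ u → sum (a u) ≡ + k
  degree-sum u = trans (sym (count-sum (adj? u))) (cong +_ (proj₁ (proj₂ srg) u))

  ⟪a,a⟫ : ∀ u s → ⟪ a u , a s ⟫ ≡ (+ k - + m) * e s u + (+ l - + m) * a u s + + m
  ⟪a,a⟫ u s = by-cases (u FinP.≟ s) (adj? u s)
    where
    common : + commonNbrs G u s ≡ ⟪ a u , a s ⟫
    common = trans (count-sum (λ t → adj? u t ×-dec adj? s t))
                   (sum-cong-≗ (λ t → ⟦∧⟧ (does (adj? u t)) (does (adj? s t))))
    by-cases : Dec (u ≡ s) → Dec (Adj u s) → ⟪ a u , a s ⟫ ≡ (+ k - + m) * e s u + (+ l - + m) * a u s + + m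
    by-cases (yes refl) _ = begin
      ⟪ a u , a u ⟫                                    ≡⟨ sum-cong-≗ (λ t → ⟦⟧-idem (does (adj? u t))) ⟩
      sum (a u)                                        ≡⟨ degree-sum u ⟩
      + k                                              ≡⟨ same (+ k) (+ l) (+ m) ⟩
      (+ k - + m) * 1ℤ + (+ l - + m) * 0ℤ + + m        ≡⟨ cong₂ (λ x y → (+ k - + m) * x + (+ l - + m) * y + + m)
                                                                 (sym (e-same u)) (sym (a-irrefl u)) ⟩
      (+ k - + m) * e u u + (+ l - + m) * a u u + + m  ∎
      where same : ∀ k l m → k ≡ (k - m) * 1ℤ + (l - m) * 0ℤ + m
            same = solve-∀
    by-cases (no u≢s) (yes u~s) = begin
      ⟪ a u , a s ⟫                                    ≡⟨ common ⟨
      + commonNbrs G u s                               ≡⟨ cong +_ (proj₁ (proj₂ (proj₂ srg)) u s u≢s u~s) ⟩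
      + l                                              ≡⟨ adjacent (+ k) (+ l) (+ m) ⟩
      (+ k - + m) * 0ℤ + (+ l - + m) * 1ℤ + + m        ≡⟨ cong₂ (λ x y → (+ k - + m) * x + (+ l - + m) * y + + m)
                                                                 (sym (e-other u≢s)) (sym (𝟙-yes (adj? u s) u~s)) ⟩
      (+ k - + m) * e s u + (+ l - + m) * a u s + + m  ∎
      where adjacent : ∀ k l m → l ≡ (k - m) * 0ℤ + (l - m) * 1ℤ + m
            adjacent = solve-∀
    by-cases (no u≢s) (no u≁s) = begin
      ⟪ a u , a s ⟫                                    ≡⟨ common ⟨
      + commonNbrs G u s                               ≡⟨ cong +_ (proj₂ (proj₂ (proj₂ srg)) u s u≢s u≁s) ⟩
      + m                                              ≡⟨ nonadjacent (+ k) (+ l) (+ m) ⟩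
      (+ k - + m) * 0ℤ + (+ l - + m) * 0ℤ + + m        ≡⟨ cong₂ (λ x y → (+ k - + m) * x + (+ l - + m) * y + + m)
                                                                 (sym (e-other u≢s)) (sym (𝟙-no (adj? u s) u≁s)) ⟩
      (+ k - + m) * e s u + (+ l - + m) * a u s + + m  ∎
      where nonadjacent : ∀ k l m → m ≡ (k - m) * 0ℤ + (l - m) * 0ℤ + m
            nonadjacent = solve-∀

  A² : ∀ w u → A (A w) u ≡ (+ k - + m) * w u + (+ l - + m) * A w u + + m * sum w
  A² w u = begin
    A (A w) u
      ≡⟨ A-def (A w) u ⟩
    ⟪ a u , A w ⟫
      ≡⟨ ⟪-,A⟫ (a u) w ⟩
    sum (λ s → A (a u) s * w s)
      ≡⟨ sum-cong-≗ (λ s → trans (cong (_* w s) (row s)) (distrib (+ k - + m) (+ l - + m) (+ m) (e u s) (a u s) (w s))) ⟩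
    sum (λ s → (+ k - + m) * (e u s * w s) + (+ l - + m) * (a u s * w s) + + m * w s)
      ≡⟨ sum-lin3 (+ k - + m) (+ l - + m) (+ m) (λ s → e u s * w s) (λ s → a u s * w s) w ⟩
    (+ k - + m) * ⟪ e u , w ⟫ + (+ l - + m) * ⟪ a u , w ⟫ + + m * sum w
      ≡⟨ cong₂ (λ x y → (+ k - + m) * x + (+ l - + m) * y + + m * sum w) (⟪e,-⟫ u w) (sym (A-def w u)) ⟩
    (+ k - + m) * w u + (+ l - + m) * A w u + + m * sum w ∎
    where
    row : ∀ s → A (a u) s ≡ (+ k - + m) * e u s + (+ l - + m) * a u s + + m
    row s = trans (A-def (a u) s) (trans (⟪a,a⟫ s u) (cong (λ b → (+ k - + m) * e u s + (+ l - + m) * b + + m) (a-sym s u)))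
    distrib : ∀ p q r x y z → (p * x + q * y + r) * z ≡ p * (x * z) + q * (y * z) + r * z
    distrib = solve-∀

  sum-A : ∀ w → sum (A w) ≡ + k * sum w
  sum-A w = begin
    sum (A w)                             ≡⟨ sum-cong-≗ (A-def w) ⟩
    sum (λ u → sum (λ t → a u t * w t))   ≡⟨ ∑-comm (λ u t → a u t * w t) ⟩
    sum (λ t → sum (λ u → a u t * w t))   ≡⟨ sum-cong-≗ (λ t → sym (*-distribʳ-sum (w t) (λ u → a u t))) ⟩
    sum (λ t → sum (λ u → a u t) * w t)   ≡⟨ sum-cong-≗ (λ t → cong (_* w t) (trans (sum-cong-≗ (λ u → a-sym u t)) (degree-sum t))) ⟩
    sum (λ t → + k * w t)                 ≡⟨ *-distribˡ-sum (+ k) w ⟨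
    + k * sum w                           ∎

  ⟪Aw,Aw⟫ : ∀ w → ⟪ A w , A w ⟫ ≡ (+ k - + m) * ⟪ w , w ⟫ + (+ l - + m) * ⟪ w , A w ⟫ + + m * (sum w * sum w)
  ⟪Aw,Aw⟫ w = begin
    ⟪ A w , A w ⟫
      ≡⟨ ⟪-,A⟫ w (A w) ⟨
    sum (λ u → w u * A (A w) u)
      ≡⟨ sum-cong-≗ (λ u → trans (cong (w u *_) (A² w u)) (distrib (w u) (A w u) (+ k - + m) (+ l - + m) (+ m * sum w))) ⟩
    sum (λ u → (+ k - + m) * (w u * w u) + (+ l - + m) * (w u * A w u) + + m * sum w * w u)
      ≡⟨ sum-lin3 (+ k - + m) (+ l - + m) (+ m * sum w) (λ u → w u * w u) (λ u → w u * A w u) w ⟩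
    (+ k - + m) * ⟪ w , w ⟫ + (+ l - + m) * ⟪ w , A w ⟫ + + m * sum w * sum w
      ≡⟨ cong (_+_ ((+ k - + m) * ⟪ w , w ⟫ + (+ l - + m) * ⟪ w , A w ⟫)) (ℤP.*-assoc (+ m) (sum w) (sum w)) ⟩
    (+ k - + m) * ⟪ w , w ⟫ + (+ l - + m) * ⟪ w , A w ⟫ + + m * (sum w * sum w) ∎
    where distrib : ∀ x y p q r → x * (p * x + q * y + r) ≡ p * (x * x) + q * (x * y) + r * x
          distrib = solve-∀

  0≤defect : ∀ θ w → 0ℤ ≤ defect n k l m θ ⟪ w , w ⟫ ⟪ w , A w ⟫ (sum w)
  0≤defect θ w =
    subst (0ℤ ≤_) (trans (cong₂ (λ X Y → + n * X - Y * Y) ⟪u,u⟫ sum-u) (sym (defect-def n k l m θ _ _ _)))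
          (i≤j⇒0≤j-i (sum²≤n*⟪w,w⟫ u))
    where
    u = λ t → A w t - θ * w t
    sum-u : sum u ≡ (+ k - θ) * sum w
    sum-u = begin
      sum u                                ≡⟨ sum-cong-≗ (λ t → split (A w t) (w t) θ) ⟩
      sum (λ t → A w t + (- θ) * w t)      ≡⟨ ∑-distrib-+ (A w) (λ t → (- θ) * w t) ⟩
      sum (A w) + sum (λ t → (- θ) * w t)  ≡⟨ cong₂ _+_ (sum-A w) (sym (*-distribˡ-sum (- θ) w)) ⟩
      + k * sum w + (- θ) * sum w          ≡⟨ collect (+ k) θ (sum w) ⟩
      (+ k - θ) * sum w                    ∎
      where split : ∀ x y θ → x - θ * y ≡ x + (- θ) * y
            split = solve-∀
            collect : ∀ k θ s → k * s + (- θ) * s ≡ (k - θ) * s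
            collect = solve-∀
    ⟪u,u⟫ : ⟪ u , u ⟫ ≡ (+ k - + m + θ * θ) * ⟪ w , w ⟫ + (+ l - + m - + 2 * θ) * ⟪ w , A w ⟫ + + m * (sum w * sum w)
    ⟪u,u⟫ = begin
      ⟪ u , u ⟫
        ≡⟨ sum-cong-≗ (λ t → expand (A w t) (w t) θ) ⟩
      sum (λ t → 1ℤ * (A w t * A w t) + (- (+ 2 * θ)) * (w t * A w t) + θ * θ * (w t * w t))
        ≡⟨ sum-lin3 1ℤ (- (+ 2 * θ)) (θ * θ) (λ t → A w t * A w t) (λ t → w t * A w t) (λ t → w t * w t) ⟩
      1ℤ * ⟪ A w , A w ⟫ + (- (+ 2 * θ)) * ⟪ w , A w ⟫ + θ * θ * ⟪ w , w ⟫
        ≡⟨ cong (λ X → 1ℤ * X + (- (+ 2 * θ)) * ⟪ w , A w ⟫ + θ * θ * ⟪ w , w ⟫) (⟪Aw,Aw⟫ w) ⟩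
      1ℤ * ((+ k - + m) * ⟪ w , w ⟫ + (+ l - + m) * ⟪ w , A w ⟫ + + m * (sum w * sum w))
        + (- (+ 2 * θ)) * ⟪ w , A w ⟫ + θ * θ * ⟪ w , w ⟫
        ≡⟨ collect (+ k) (+ l) (+ m) θ ⟪ w , w ⟫ ⟪ w , A w ⟫ (sum w * sum w) ⟩
      (+ k - + m + θ * θ) * ⟪ w , w ⟫ + (+ l - + m - + 2 * θ) * ⟪ w , A w ⟫ + + m * (sum w * sum w) ∎
      where expand : ∀ x y θ → (x - θ * y) * (x - θ * y) ≡ 1ℤ * (x * x) + (- (+ 2 * θ)) * (y * x) + θ * θ * (y * y)
            expand = solve-∀
            collect : ∀ k l m θ Q R S → 1ℤ * ((k - m) * Q + (l - m) * R + m * S) + (- (+ 2 * θ)) * R + θ * θ * Q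
                                          ≡ (k - m + θ * θ) * Q + (l - m - + 2 * θ) * R + m * S
            collect = solve-∀

-- Cliques

module Clique {n} (G : Graph n) {s} (K : Fin s → Fin n) (clique : IsClique G K) where
  open Graph G using (Adj; adj?; irrefl)
  open Adjacency G

  K-injective : ∀ {i j} → K i ≡ K j → i ≡ j
  K-injective {i} {j} Ki≡Kj = decidable-stable (i FinP.≟ j)
    λ i≢j → irrefl (subst (Adj (K i)) (sym Ki≡Kj) (clique i j i≢j))

  e-K : ∀ i j → e (K i) (K j) ≡ e i j
  e-K i j = cong ⟦_⟧ (does-⇔ (mk⇔ K-injective (cong K)) (K j FinP.≟ K i) (j FinP.≟ i))

  χ : Fin n → ℤ
  χ u = sum (λ j → e (K j) u)

  χ-K : ∀ j → χ (K j) ≡ 1ℤ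
  χ-K j = trans (sum-cong-≗ (λ i → trans (e-K i j) (e-sym i j))) (sum-e j)

  χ-outside : ∀ {u} → ¬ InK G K u → χ u ≡ 0ℤ
  χ-outside u∉K = trans (sum-cong-≗ (λ j → e-other λ u≡Kj → u∉K (j , sym u≡Kj))) (sum-replicate-zero s)

  Aχ≡∑a : ∀ u → A χ u ≡ sum (λ j → a u (K j))
  Aχ≡∑a u = trans (A-def χ u) (trans (⟪-,∑⟫ (a u) (e ∘ K)) (sum-cong-≗ (λ j → ⟪-,e⟫ (a u) (K j))))

  nbrsInK≡Aχ : ∀ u → + nbrsInK G K u ≡ A χ u
  nbrsInK≡Aχ u = trans (count-sum (λ j → adj? u (K j))) (sym (Aχ≡∑a u))

  Aχ-K : ∀ j → A χ (K j) ≡ + s - 1ℤ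
  Aχ-K j = begin
    A χ (K j)                                   ≡⟨ Aχ≡∑a (K j) ⟩
    sum (λ i → a (K j) (K i))                   ≡⟨ sum-cong-≗ (λ i → a-KK i (i FinP.≟ j)) ⟩
    sum (λ i → 1ℤ + -1ℤ * e j i)                ≡⟨ ∑-distrib-+ (λ _ → 1ℤ) (λ i → -1ℤ * e j i) ⟩
    sum {s} (λ _ → 1ℤ) + sum (λ i → -1ℤ * e j i)
      ≡⟨ cong₂ _+_ (sum-const {s} 1ℤ) (trans (sym (*-distribˡ-sum -1ℤ (e j))) (cong (-1ℤ *_) (sum-e j))) ⟩
    + s * 1ℤ + -1ℤ * 1ℤ                         ≡⟨ cong (_+ -1ℤ) (ℤP.*-identityʳ (+ s)) ⟩
    + s - 1ℤ                                    ∎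
    where
    a-KK : ∀ i → Dec (i ≡ j) → a (K j) (K i) ≡ 1ℤ + -1ℤ * e j i
    a-KK i (yes refl) = trans (a-irrefl (K i)) (cong (λ x → 1ℤ + -1ℤ * x) (sym (e-same i)))
    a-KK i (no i≢j)   = trans (𝟙-yes (adj? (K j) (K i)) (clique j i (i≢j ∘ sym)))
                              (cong (λ x → 1ℤ + -1ℤ * x) (sym (e-other i≢j)))

  sum-χ : sum χ ≡ + s
  sum-χ = begin
    sum χ                       ≡⟨ ∑-comm (λ u j → e (K j) u) ⟩
    sum (λ j → sum (e (K j)))   ≡⟨ sum-cong-≗ (λ j → sum-e (K j)) ⟩
    sum {s} (λ _ → 1ℤ)          ≡⟨ sum-const {s} 1ℤ ⟩
    + s * 1ℤ                    ≡⟨ ℤP.*-identityʳ (+ s) ⟩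
    + s                         ∎

  ⟪χ,χ⟫ : ⟪ χ , χ ⟫ ≡ + s
  ⟪χ,χ⟫ = begin
    ⟪ χ , χ ⟫                       ≡⟨ ⟪-,∑⟫ χ (e ∘ K) ⟩
    sum (λ j → ⟪ χ , e (K j) ⟫)     ≡⟨ sum-cong-≗ (λ j → trans (⟪-,e⟫ χ (K j)) (χ-K j)) ⟩
    sum {s} (λ _ → 1ℤ)              ≡⟨ trans (sum-const {s} 1ℤ) (ℤP.*-identityʳ (+ s)) ⟩
    + s                             ∎

  ⟪χ,Aχ⟫ : ⟪ χ , A χ ⟫ ≡ + s * (+ s - 1ℤ)
  ⟪χ,Aχ⟫ = begin
    ⟪ χ , A χ ⟫                     ≡⟨ ⟪⟫-comm χ (A χ) ⟩
    ⟪ A χ , χ ⟫                     ≡⟨ ⟪-,∑⟫ (A χ) (e ∘ K) ⟩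
    sum (λ j → ⟪ A χ , e (K j) ⟫)   ≡⟨ sum-cong-≗ (λ j → trans (⟪-,e⟫ (A χ) (K j)) (Aχ-K j)) ⟩
    sum {s} (λ _ → + s - 1ℤ)        ≡⟨ sum-const {s} (+ s - 1ℤ) ⟩
    + s * (+ s - 1ℤ)                ∎

-- The configuration of the theorem

-- The Gram data of the vectors χ_K, e_z, e_x, e_y, e_d (in this order) for a
-- 4-clique K, a vertex z ∈ X₀, vertices x, y ∈ X₃ and a vertex d ∈ K: their
-- inner products, the inner products with their images under A, and their sums.
-- The only unknowns are the adjacencies zx, zy, xy and yd inside {z, x, y, d}.

χ-at Aχ-at : Fin 4 → ℤ
χ-at = lookup (0ℤ ∷ 0ℤ ∷ 0ℤ ∷ 1ℤ ∷ [])
Aχ-at = lookup (0ℤ ∷ + 3 ∷ + 3 ∷ + 3 ∷ [])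

gram : Fin 5 → Fin 5 → ℤ
gram zero    zero    = + 4
gram zero    (suc j) = χ-at j
gram (suc i) zero    = χ-at i
gram (suc i) (suc j) = e j i

adjGram : (Fin 4 → Fin 4 → Bool) → Fin 5 → Fin 5 → ℤ
adjGram E zero    zero    = + 12
adjGram E zero    (suc j) = Aχ-at j
adjGram E (suc i) zero    = Aχ-at i
adjGram E (suc i) (suc j) = ⟦ E i j ⟧

sums : Fin 5 → ℤ
sums zero    = + 4
sums (suc _) = 1ℤ

pointAdj : Bool → Bool → Bool → Bool → Fin 4 → Fin 4 → Bool
pointAdj zx zy xy yd i j = lookup (lookup
  ( (false ∷ zx    ∷ zy    ∷ false ∷ [])
  ∷ (zx    ∷ false ∷ xy    ∷ false ∷ [])
  ∷ (zy    ∷ xy    ∷ false ∷ yd    ∷ [])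
  ∷ (false ∷ false ∷ yd    ∷ false ∷ [])
  ∷ []) i) j

Ψ : (Fin 5 → ℤ) → (Fin 4 → Fin 4 → Bool) → ℤ
Ψ c E = defect 95 40 12 20 (+ 2) (quadForm c gram) (quadForm c (adjGram E)) (linForm c sums)

-- Reading the Booleans as 0/1,
--   Ψ c-zx (pointAdj zx zy xy yd) = 456 (20 zx + 10 zy − 10 xy − 11),
--   Ψ c-xy (pointAdj zx zy xy yd) = 456 (30 zx + 30 zy − 45 xy + 15 yd − 31).
c-zx c-xy : Fin 5 → ℤ
c-zx = lookup (+ 3 ∷ -[1+ 1 ] ∷ + 2 ∷ 1ℤ ∷ 0ℤ ∷ [])
c-xy = lookup (+ 5 ∷ -[1+ 1 ] ∷ + 3 ∷ + 3 ∷ -1ℤ ∷ [])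

opaque
  unfolding defect

  adjacency-forced : ∀ zx zy xy yd →
                     0ℤ ≤ Ψ c-zx (pointAdj zx zy xy yd) → 0ℤ ≤ Ψ c-xy (pointAdj zx zy xy yd) →
                     zx ≡ true × xy ≡ false
  adjacency-forced true  _     false _     _  _  = refl , refl
  adjacency-forced false false false false () _
  adjacency-forced false false false true  () _
  adjacency-forced false false true  false () _
  adjacency-forced false false true  true  () _
  adjacency-forced false true  false false () _
  adjacency-forced false true  false true  () _
  adjacency-forced false true  true  false () _
  adjacency-forced false true  true  true  () _
  adjacency-forced true  false true  false _ ()
  adjacency-forced true  false true  true  _ ()
  adjacency-forced true  true  true  false _ ()
  adjacency-forced true  true  true  true  _ ()

-- 𝟙_{X₂} = A χ_K − 1 + 𝟙_{X₀} − 2·𝟙_{X₃} − 2 χ_K: outside K, with i ≤ 3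
-- neighbours in K, this is [i = 2] = i − 1 + [i = 0] − 2 [i = 3]; on K both sides vanish.
X₂-coeffs : Fin 5 → ℤ
X₂-coeffs = lookup (1ℤ ∷ -1ℤ ∷ 1ℤ ∷ -[1+ 1 ] ∷ -[1+ 1 ] ∷ [])

outside-values : ℕ → Fin 5 → ℤ
outside-values i = lookup (+ i ∷ 1ℤ ∷ ⟦ does (i ℕP.≟ 0) ⟧ ∷ ⟦ does (i ℕP.≟ 3) ⟧ ∷ 0ℤ ∷ [])

inside-values : Fin 5 → ℤ
inside-values = lookup (+ 3 ∷ 1ℤ ∷ 0ℤ ∷ 0ℤ ∷ 1ℤ ∷ [])

X₂-interpolation : ∀ i → i ℕ.≤ 3 → linForm X₂-coeffs (outside-values i) ≡ ⟦ does (i ℕP.≟ 2) ⟧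
X₂-interpolation 0 _ = refl
X₂-interpolation 1 _ = refl
X₂-interpolation 2 _ = refl
X₂-interpolation 3 _ = refl
X₂-interpolation (suc (suc (suc (suc _)))) (s≤s (s≤s (s≤s ())))

module Configuration
  (G : Graph 95) (srg : IsSRG G 95 40 12 20)
  (K : Fin 4 → Fin 95) (clique : IsClique G K) (maximal : ¬ InLargerClique G K)
  (z : Fin 95) (z∈X₀ : InX G K 0 z) (X₀≗e-z : 𝟙 ∘ inX? G K 0 ≗ e z)
  (x y : Fin 95) (x∈X₃ : InX G K 3 x) (y∈X₃ : InX G K 3 y) (y≢x : y ≢ x)
  (X₃≗e-x+e-y : 𝟙 ∘ inX? G K 3 ≗ (λ u → e x u + e y u))
  (j₀ : Fin 4) (x≁d : ¬ Graph.Adj G x (K j₀))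
  where
  open Graph G using (Adj; adj?; irrefl) renaming (sym to adj-sym)
  open Adjacency G
  open StronglyRegular G srg
  open Clique G K clique

  d : Fin 95
  d = K j₀

  Aχ-X : ∀ {i u} → InX G K i u → A χ u ≡ + i
  Aχ-X {i} {u} (_ , nbrs≡i) = trans (sym (nbrsInK≡Aχ u)) (cong +_ nbrs≡i)

  z≁d : ¬ Adj z d
  z≁d = count≡0⇒none (λ j → adj? z (K j)) (proj₂ z∈X₀) j₀

  X≢d : ∀ {i u} → InX G K i u → u ≢ d
  X≢d (u∉K , _) u≡d = u∉K (j₀ , sym u≡d)

  X₀≢X₃ : ∀ {u v} → InX G K 0 u → InX G K 3 v → u ≢ v
  X₀≢X₃ (_ , u0) (_ , v3) refl with trans (sym u0) v3
  ... | ()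

  pt : Fin 4 → Fin 95
  pt zero                   = z
  pt (suc zero)             = x
  pt (suc (suc zero))       = y
  pt (suc (suc (suc zero))) = d

  pt-injective : ∀ {i j} → pt i ≡ pt j → i ≡ j
  pt-injective {zero}                 {zero}                 _   = refl
  pt-injective {suc zero}             {suc zero}             _   = refl
  pt-injective {suc (suc zero)}       {suc (suc zero)}       _   = refl
  pt-injective {suc (suc (suc zero))} {suc (suc (suc zero))} _   = refl
  pt-injective {zero}                 {suc zero}             z≡x = ⊥-elim (X₀≢X₃ z∈X₀ x∈X₃ z≡x)
  pt-injective {zero}                 {suc (suc zero)}       z≡y = ⊥-elim (X₀≢X₃ z∈X₀ y∈X₃ z≡y)
  pt-injective {zero}                 {suc (suc (suc zero))} z≡d = ⊥-elim (X≢d z∈X₀ z≡d)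
  pt-injective {suc zero}             {zero}                 x≡z = ⊥-elim (X₀≢X₃ z∈X₀ x∈X₃ (sym x≡z))
  pt-injective {suc zero}             {suc (suc zero)}       x≡y = ⊥-elim (y≢x (sym x≡y))
  pt-injective {suc zero}             {suc (suc (suc zero))} x≡d = ⊥-elim (X≢d x∈X₃ x≡d)
  pt-injective {suc (suc zero)}       {zero}                 y≡z = ⊥-elim (X₀≢X₃ z∈X₀ y∈X₃ (sym y≡z))
  pt-injective {suc (suc zero)}       {suc zero}             y≡x = ⊥-elim (y≢x y≡x)
  pt-injective {suc (suc zero)}       {suc (suc (suc zero))} y≡d = ⊥-elim (X≢d y∈X₃ y≡d)
  pt-injective {suc (suc (suc zero))} {zero}                 d≡z = ⊥-elim (X≢d z∈X₀ (sym d≡z))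
  pt-injective {suc (suc (suc zero))} {suc zero}             d≡x = ⊥-elim (X≢d x∈X₃ (sym d≡x))
  pt-injective {suc (suc (suc zero))} {suc (suc zero)}       d≡y = ⊥-elim (X≢d y∈X₃ (sym d≡y))

  e-pt : ∀ i j → e (pt i) (pt j) ≡ e i j
  e-pt i j = cong ⟦_⟧ (does-⇔ (mk⇔ pt-injective (cong pt)) (pt j FinP.≟ pt i) (j FinP.≟ i))

  χ-pt : ∀ i → χ (pt i) ≡ χ-at i
  χ-pt zero                   = χ-outside (proj₁ z∈X₀)
  χ-pt (suc zero)             = χ-outside (proj₁ x∈X₃)
  χ-pt (suc (suc zero))       = χ-outside (proj₁ y∈X₃)
  χ-pt (suc (suc (suc zero))) = χ-K j₀

  Aχ-pt : ∀ i → A χ (pt i) ≡ Aχ-at i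
  Aχ-pt zero                   = Aχ-X z∈X₀
  Aχ-pt (suc zero)             = Aχ-X x∈X₃
  Aχ-pt (suc (suc zero))       = Aχ-X y∈X₃
  Aχ-pt (suc (suc (suc zero))) = Aχ-K j₀

  zx zy xy yd : Bool
  zx = does (adj? z x)
  zy = does (adj? z y)
  xy = does (adj? x y)
  yd = does (adj? y d)

  pt-adjacency : ∀ i j → does (adj? (pt i) (pt j)) ≡ pointAdj zx zy xy yd i j
  pt-adjacency zero                   zero                   = dec-false (adj? z z) irrefl
  pt-adjacency zero                   (suc zero)             = refl
  pt-adjacency zero                   (suc (suc zero))       = refl
  pt-adjacency zero                   (suc (suc (suc zero))) = dec-false (adj? z d) z≁d
  pt-adjacency (suc zero)             zero                   = does-adj-sym x z
  pt-adjacency (suc zero)             (suc zero)             = dec-false (adj? x x) irrefl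
  pt-adjacency (suc zero)             (suc (suc zero))       = refl
  pt-adjacency (suc zero)             (suc (suc (suc zero))) = dec-false (adj? x d) x≁d
  pt-adjacency (suc (suc zero))       zero                   = does-adj-sym y z
  pt-adjacency (suc (suc zero))       (suc zero)             = does-adj-sym y x
  pt-adjacency (suc (suc zero))       (suc (suc zero))       = dec-false (adj? y y) irrefl
  pt-adjacency (suc (suc zero))       (suc (suc (suc zero))) = refl
  pt-adjacency (suc (suc (suc zero))) zero                   = dec-false (adj? d z) (z≁d ∘ adj-sym)
  pt-adjacency (suc (suc (suc zero))) (suc zero)             = dec-false (adj? d x) (x≁d ∘ adj-sym)
  pt-adjacency (suc (suc (suc zero))) (suc (suc zero))       = does-adj-sym d y
  pt-adjacency (suc (suc (suc zero))) (suc (suc (suc zero))) = dec-false (adj? d d) irrefl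

  basis : Fin 5 → Fin 95 → ℤ
  basis zero    = χ
  basis (suc i) = e (pt i)

  basis-gram : ∀ k l → ⟪ basis k , basis l ⟫ ≡ gram k l
  basis-gram zero    zero    = ⟪χ,χ⟫
  basis-gram zero    (suc j) = trans (⟪-,e⟫ χ (pt j)) (χ-pt j)
  basis-gram (suc i) zero    = trans (⟪e,-⟫ (pt i) χ) (χ-pt i)
  basis-gram (suc i) (suc j) = trans (⟪e,-⟫ (pt i) (e (pt j))) (e-pt j i)

  basis-adjGram : ∀ k l → ⟪ basis k , A (basis l) ⟫ ≡ adjGram (pointAdj zx zy xy yd) k l
  basis-adjGram zero    zero    = ⟪χ,Aχ⟫
  basis-adjGram zero    (suc j) = trans (⟪-,A⟫ χ (e (pt j))) (trans (⟪-,e⟫ (A χ) (pt j)) (Aχ-pt j))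
  basis-adjGram (suc i) zero    = trans (⟪e,-⟫ (pt i) (A χ)) (Aχ-pt i)
  basis-adjGram (suc i) (suc j) = trans (⟪e,-⟫ (pt i) (A (e (pt j))))
                                        (trans (A-e (pt j) (pt i)) (cong ⟦_⟧ (pt-adjacency i j)))

  basis-sum : ∀ k → sum (basis k) ≡ sums k
  basis-sum zero    = sum-χ
  basis-sum (suc i) = sum-e (pt i)

  0≤Ψ : ∀ c → 0ℤ ≤ Ψ c (pointAdj zx zy xy yd)
  0≤Ψ c = subst (0ℤ ≤_) (trans (cong (λ Q → defect 95 40 12 20 (+ 2) Q ⟪ v , A v ⟫ (sum v)) ⟪v,v⟫)
                               (cong₂ (defect 95 40 12 20 (+ 2) (quadForm c gram)) ⟪v,Av⟫ sum-v))
                  (0≤defect (+ 2) v)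
    where
    v = lc c basis
    ⟪v,v⟫ : ⟪ v , v ⟫ ≡ quadForm c gram
    ⟪v,v⟫ = trans (⟪lc,lc⟫ c basis basis) (quadForm-cong c basis-gram)
    ⟪v,Av⟫ : ⟪ v , A v ⟫ ≡ quadForm c (adjGram (pointAdj zx zy xy yd))
    ⟪v,Av⟫ = begin
      ⟪ v , A v ⟫                                     ≡⟨ sum-cong-≗ (λ u → cong (v u *_) (A-lc c basis u)) ⟩
      ⟪ v , lc c (A ∘ basis) ⟫                        ≡⟨ ⟪lc,lc⟫ c basis (A ∘ basis) ⟩
      quadForm c (λ k l → ⟪ basis k , A (basis l) ⟫)  ≡⟨ quadForm-cong c basis-adjGram ⟩
      quadForm c (adjGram (pointAdj zx zy xy yd))      ∎
    sum-v : sum v ≡ linForm c sums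
    sum-v = trans (sum-lc c basis) (linForm-cong c basis-sum)

  x~z×x≁y : zx ≡ true × xy ≡ false
  x~z×x≁y = adjacency-forced zx zy xy yd (0≤Ψ c-zx) (0≤Ψ c-xy)

  X : ℕ → Fin 95 → ℤ
  X i = 𝟙 ∘ inX? G K i

  X-outside : ∀ {u} → ¬ InK G K u → ∀ i → X i u ≡ ⟦ does (nbrsInK G K u ℕP.≟ i) ⟧
  X-outside {u} u∉K i = cong (λ b → ⟦ not b ∧ does (nbrsInK G K u ℕP.≟ i) ⟧) (dec-false (inK? G K u) u∉K)

  X-inside : ∀ j i → X i (K j) ≡ 0ℤ
  X-inside j i = 𝟙-no (inX? G K i (K j)) (λ (Kj∉K , _) → Kj∉K (j , refl))

  nbrsInK≤3 : ∀ {u} → ¬ InK G K u → nbrsInK G K u ℕ.≤ 3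
  nbrsInK≤3 {u} u∉K = ℕP.≤-pred (ℕP.≤∧≢⇒< (count≤n (λ j → adj? u (K j))) (maximal ∘ larger))
    where
    larger : nbrsInK G K u ≡ 4 → InLargerClique G K
    larger nbrs≡4 = L , L-clique , λ j → suc j , refl
      where
      u~K : ∀ j → Adj u (K j)
      u~K = count≡n⇒all (λ j → adj? u (K j)) nbrs≡4
      L : Fin 5 → Fin 95
      L zero    = u
      L (suc j) = K j
      L-clique : IsClique G L
      L-clique zero    zero    0≢0 = ⊥-elim (0≢0 refl)
      L-clique zero    (suc j) _   = u~K j
      L-clique (suc i) zero    _   = adj-sym (u~K i)
      L-clique (suc i) (suc j) i≢j = clique i j (i≢j ∘ cong suc)

  X₂-parts : Fin 5 → Fin 95 → ℤ
  X₂-parts zero                         = A χ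
  X₂-parts (suc zero)                   = λ _ → 1ℤ
  X₂-parts (suc (suc zero))             = X 0
  X₂-parts (suc (suc (suc zero)))       = X 3
  X₂-parts (suc (suc (suc (suc zero)))) = χ

  X₂-decomposition : ∀ u → X 2 u ≡ lc X₂-coeffs X₂-parts u
  X₂-decomposition u = by-cases (inK? G K u)
    where
    by-cases : Dec (InK G K u) → X 2 u ≡ lc X₂-coeffs X₂-parts u
    by-cases (yes (j , refl)) = trans (X-inside j 2) (sym (linForm-cong X₂-coeffs inside))
      where
      inside : ∀ k → X₂-parts k (K j) ≡ inside-values k
      inside zero                         = Aχ-K j
      inside (suc zero)                   = refl
      inside (suc (suc zero))             = X-inside j 0
      inside (suc (suc (suc zero)))       = X-inside j 3
      inside (suc (suc (suc (suc zero)))) = χ-K j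
    by-cases (no u∉K) = begin
      X 2 u                                               ≡⟨ X-outside u∉K 2 ⟩
      ⟦ does (nbrsInK G K u ℕP.≟ 2) ⟧                     ≡⟨ X₂-interpolation _ (nbrsInK≤3 u∉K) ⟨
      linForm X₂-coeffs (outside-values (nbrsInK G K u))  ≡⟨ linForm-cong X₂-coeffs outside ⟨
      lc X₂-coeffs X₂-parts u                             ∎
      where
      outside : ∀ k → X₂-parts k u ≡ outside-values (nbrsInK G K u) k
      outside zero                         = sym (nbrsInK≡Aχ u)
      outside (suc zero)                   = refl
      outside (suc (suc zero))             = X-outside u∉K 0
      outside (suc (suc (suc zero)))       = X-outside u∉K 3
      outside (suc (suc (suc (suc zero)))) = χ-outside u∉K

  X₂-parts-at-x : ∀ k → A (X₂-parts k) x ≡ lookup (+ 56 ∷ + 40 ∷ 1ℤ ∷ 0ℤ ∷ + 3 ∷ []) k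
  X₂-parts-at-x zero = begin
    A (A χ) x                                                   ≡⟨ A² χ x ⟩
    (+ 40 - + 20) * χ x + (+ 12 - + 20) * A χ x + + 20 * sum χ
      ≡⟨ cong₂ (λ p q → (+ 40 - + 20) * p + (+ 12 - + 20) * q + + 20 * sum χ) (χ-outside (proj₁ x∈X₃)) (Aχ-X x∈X₃) ⟩
    (+ 40 - + 20) * 0ℤ + (+ 12 - + 20) * + 3 + + 20 * sum χ
      ≡⟨ cong (λ p → (+ 40 - + 20) * 0ℤ + (+ 12 - + 20) * + 3 + + 20 * p) sum-χ ⟩
    + 56                                                        ∎
  X₂-parts-at-x (suc zero) =
    trans (A-def (λ _ → 1ℤ) x) (trans (sum-cong-≗ (λ t → ℤP.*-identityʳ (a x t))) (degree-sum x))
  X₂-parts-at-x (suc (suc zero)) = begin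
    A (X 0) x  ≡⟨ A-cong X₀≗e-z x ⟩
    A (e z) x  ≡⟨ A-e z x ⟩
    a x z      ≡⟨ a-sym x z ⟩
    ⟦ zx ⟧     ≡⟨ cong ⟦_⟧ (proj₁ x~z×x≁y) ⟩
    1ℤ         ∎
  X₂-parts-at-x (suc (suc (suc zero))) = begin
    A (X 3) x                  ≡⟨ A-cong X₃≗e-x+e-y x ⟩
    A (λ u → e x u + e y u) x  ≡⟨ A-+ (e x) (e y) x ⟩
    A (e x) x + A (e y) x      ≡⟨ cong₂ _+_ (A-e x x) (A-e y x) ⟩
    a x x + ⟦ xy ⟧             ≡⟨ cong₂ _+_ (a-irrefl x) (cong ⟦_⟧ (proj₂ x~z×x≁y)) ⟩
    0ℤ                         ∎
  X₂-parts-at-x (suc (suc (suc (suc zero)))) = Aχ-X x∈X₃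

  nbrsInX₂≡11 : nbrsInX G K 2 x ≡ 11
  nbrsInX₂≡11 = ℤP.+-injective (begin
    + nbrsInX G K 2 x                           ≡⟨ A-count (inX? G K 2) x ⟩
    A (X 2) x                                   ≡⟨ A-cong X₂-decomposition x ⟩
    A (lc X₂-coeffs X₂-parts) x                 ≡⟨ A-lc X₂-coeffs X₂-parts x ⟩
    linForm X₂-coeffs (λ k → A (X₂-parts k) x)  ≡⟨ linForm-cong X₂-coeffs X₂-parts-at-x ⟩
    + 11                                        ∎)

lemma5 : (G : Graph 95) → IsSRG G 95 40 12 20 →
         (K : Fin 4 → Fin 95) → IsClique G K → ¬ InLargerClique G K →
         sizeX G K 0 ≡ 1 → sizeX G K 1 ≡ 34 → sizeX G K 2 ≡ 54 → sizeX G K 3 ≡ 2 →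
         (x : Fin 95) → InX G K 3 x → nbrsInX G K 2 x ≡ 11
lemma5 G srg K clique maximal |X₀|≡1 _ _ |X₃|≡2 x x∈X₃ =
  let z , z∈X₀ , X₀≗e-z           = count≡1⇒singleton (inX? G K 0) |X₀|≡1
      y , y≢x , y∈X₃ , X₃≗e-x+e-y = count≡2⇒pair (inX? G K 3) |X₃|≡2 x∈X₃
      j₀ , x≁d                    = FinP.¬∀⟶∃¬ 4 _ (λ j → Graph.adj? G x (K j)) x-misses-K
  in Configuration.nbrsInX₂≡11 G srg K clique maximal
       z z∈X₀ X₀≗e-z x y x∈X₃ y∈X₃ y≢x X₃≗e-x+e-y j₀ x≁d
  where
  x-misses-K : ¬ (∀ j → Graph.Adj G x (K j))
  x-misses-K x~K with trans (sym (proj₂ x∈X₃)) (all⇒count≡n (λ j → Graph.adj? G x (K j)) x~K)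
  ... | ()
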